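{- Let $c,c'\in\{0,1,\diamondsuit\}$ and let $X,Y$ be binary partial words of the same length. Then the solid string $11h(Xc)0$ occurs in the partial word $\mu(c'Y)\,010\,\diamondsuit\diamondsuit$ if and only if $c\not\approx c'$, where $h$ and $\mu$ are the morphisms $h(0)=0100$, $h(1)=0001$, $h(\diamondsuit)=0000$ and $\mu(0)=\diamondsuit\diamondsuit0\diamondsuit$, $\mu(1)=0\diamondsuit\diamondsuit\diamondsuit$, $\mu(\diamondsuit)=0\diamondsuit0\diamondsuit$.
   Context: Binary partial words are strings over $\{0,1,\diamondsuit\}$, where $\diamondsuit$ is a don't care symbol matching both $0$ and $1$; a solid string contains no $\diamondsuit$. Two partial words $U,V$ match ($U\approx V$) if $|U|=|V|$ and for each $i$, $U[i]=V[i]$ or one of them is $\diamondsuit$; in particular for single symbols, $c\not\approx c'$ means $\{c,c'\}=\{0,1\}$. A solid string $S$ occurs in a partial word $Q$ if $S\approx Q[j..j+|S|-1]$ for some position $j$. Morphisms are extended to words letterwise. -}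

module Defs where

open import Data.List using (List; []; _∷_; _++_; length; drop; take; concatMap; [_])
open import Data.List.Relation.Binary.Pointwise using (Pointwise)
open import Data.Nat using (ℕ)
open import Data.Product using (∃)
open import Relation.Binary.PropositionalEquality using (_≡_)
open import Data.Empty using (⊥)
open import Data.Unit using (⊤)

data Bit : Set where
  b0 b1 : Bit

data PSym : Set where
  p0 p1 ◇ : PSym

SolidWord : Set
SolidWord = List Bit

PWord : Set
PWord = List PSym

_≈ₛ_ : PSym → PSym → Set
p0 ≈ₛ p1 = ⊥
p1 ≈ₛ p0 = ⊥
_  ≈ₛ _  = ⊤

solid : Bit → PSym
solid b0 = p0
solid b1 = p1

_≈ᵂ_ : SolidWord → PWord → Set
S ≈ᵂ Q = Pointwise (λ b q → solid b ≈ₛ q) S Q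

OccursIn : SolidWord → PWord → Set
OccursIn S Q = ∃ λ (j : ℕ) → S ≈ᵂ take (length S) (drop j Q)

hₛ : PSym → SolidWord
hₛ p0 = b0 ∷ b1 ∷ b0 ∷ b0 ∷ []
hₛ p1 = b0 ∷ b0 ∷ b0 ∷ b1 ∷ []
hₛ ◇  = b0 ∷ b0 ∷ b0 ∷ b0 ∷ []

h : PWord → SolidWord
h = concatMap hₛ

μₛ : PSym → PWord
μₛ p0 = ◇ ∷ ◇ ∷ p0 ∷ ◇ ∷ []
μₛ p1 = p0 ∷ ◇ ∷ ◇ ∷ ◇ ∷ []
μₛ ◇  = p0 ∷ ◇ ∷ p0 ∷ ◇ ∷ []

μ : PWord → PWord
μ = concatMap μₛ

-- Cut both words into letter pairs: every pair of an h-image is 0x and every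
-- pair of a μ-image is u◇ with u ∈ {0,◇}, so an h-image matches a μ-image
-- wherever the two are aligned on pairs, whatever X and Y are. The needle
-- 11h(Xc)0 is only two letters shorter than μ(c'Y)010◇◇, so it can sit only at
-- shifts 0, 1 and 2, and there the outcome is decided by the letters at the two
-- ends: shift 0 works exactly when c = 1 and c' = 0, shift 2 exactly when c = 0
-- and c' = 1, and shift 1 never, since the suffix puts a 1 against a 0 of h(c).
module Submission where

open import Defs
open import Data.List using (List; []; _∷_; _++_; length; [_]; drop; take; concatMap)
open import Data.List.Properties using (length-++; ++-assoc; ++-identityʳ; length-take; length-drop; concatMap-++)
open import Data.List.Relation.Binary.Pointwise using ([]; _∷_; Pointwise-length)
open import Data.Nat using (ℕ; suc; _+_; _*_; _≤_; s≤s⁻¹)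
open import Data.Nat.Properties using (+-comm; m⊓n≤n; m∸n≤m; ≤-trans; ≤-reflexive; 1+n≰n; suc-injective)
open import Data.Product using (_,_)
open import Data.Unit using (tt)
open import Data.Empty using (⊥-elim)
open import Function.Bundles using (_⇔_; mk⇔)
open import Relation.Binary.PropositionalEquality using (_≡_; refl; sym; trans; cong; cong₂; subst₂; module ≡-Reasoning)
open import Relation.Nullary using (¬_)

open ≡-Reasoning

infix 4 _≼_

_≼_ : SolidWord → PWord → Set
S ≼ Q = S ≈ᵂ take (length S) Q

≼-++⁺ : ∀ {U V R T} → U ≈ᵂ V → R ≼ T → (U ++ R) ≼ (V ++ T)
≼-++⁺ []       R≼T = R≼T
≼-++⁺ (p ∷ ps) R≼T = p ∷ ≼-++⁺ ps R≼T

≼-++⁻ʳ : ∀ U V {R T} → length U ≡ length V → (U ++ R) ≼ (V ++ T) → R ≼ T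
≼-++⁻ʳ []      []      _ R≼T     = R≼T
≼-++⁻ʳ (_ ∷ U) (_ ∷ V) e (_ ∷ m) = ≼-++⁻ʳ U V (suc-injective e) m

≼⇒length≤ : ∀ {S Q} → S ≼ Q → length S ≤ length Q
≼⇒length≤ {S} {Q} m = ≤-trans (≤-reflexive (trans (Pointwise-length m) (length-take (length S) Q)))
                               (m⊓n≤n (length S) (length Q))

≈ₛ-◇ : ∀ q → q ≈ₛ ◇
≈ₛ-◇ p0 = tt
≈ₛ-◇ p1 = tt
≈ₛ-◇ ◇  = tt

data ZeroPairs : ℕ → SolidWord → Set where
  []  : ZeroPairs 0 []
  _∷_ : ∀ {n S} b → ZeroPairs n S → ZeroPairs (suc n) (b0 ∷ b ∷ S)

data HolePairs : ℕ → PWord → Set where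
  []  : HolePairs 0 []
  _∷_ : ∀ {n Q u} → solid b0 ≈ₛ u → HolePairs n Q → HolePairs (suc n) (u ∷ ◇ ∷ Q)

ZeroPairs-++ : ∀ {m n S S'} → ZeroPairs m S → ZeroPairs n S' → ZeroPairs (m + n) (S ++ S')
ZeroPairs-++ []       zs' = zs'
ZeroPairs-++ (b ∷ zs) zs' = b ∷ ZeroPairs-++ zs zs'

HolePairs-++ : ∀ {m n Q Q'} → HolePairs m Q → HolePairs n Q' → HolePairs (m + n) (Q ++ Q')
HolePairs-++ []       hs' = hs'
HolePairs-++ (u ∷ hs) hs' = u ∷ HolePairs-++ hs hs'

ZeroPairs≈HolePairs : ∀ {m n S Q} → ZeroPairs m S → HolePairs n Q → m ≡ n → S ≈ᵂ Q
ZeroPairs≈HolePairs []       []       _ = []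
ZeroPairs≈HolePairs (b ∷ zs) (u ∷ hs) e = u ∷ ≈ₛ-◇ (solid b) ∷ ZeroPairs≈HolePairs zs hs (suc-injective e)

h-ZeroPairs : ∀ X → ZeroPairs (length X * 2) (h X)
h-ZeroPairs []       = []
h-ZeroPairs (p0 ∷ X) = b1 ∷ b0 ∷ h-ZeroPairs X
h-ZeroPairs (p1 ∷ X) = b0 ∷ b1 ∷ h-ZeroPairs X
h-ZeroPairs (◇  ∷ X) = b0 ∷ b0 ∷ h-ZeroPairs X

μ-HolePairs : ∀ Y → HolePairs (length Y * 2) (μ Y)
μ-HolePairs []       = []
μ-HolePairs (p0 ∷ Y) = tt ∷ tt ∷ μ-HolePairs Y
μ-HolePairs (p1 ∷ Y) = tt ∷ tt ∷ μ-HolePairs Y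
μ-HolePairs (◇  ∷ Y) = tt ∷ tt ∷ μ-HolePairs Y

length-concatMap : ∀ {A B : Set} {f : A → List B} {k} → (∀ x → length (f x) ≡ k) →
                   ∀ xs → length (concatMap f xs) ≡ length xs * k
length-concatMap          uniform []       = refl
length-concatMap {f = f} uniform (x ∷ xs) =
  trans (length-++ (f x)) (cong₂ _+_ (uniform x) (length-concatMap uniform xs))

length-h≡length-μ : ∀ X Y → length X ≡ length Y → length (h X) ≡ length (μ Y)
length-h≡length-μ X Y e = begin
  length (h X)    ≡⟨ length-concatMap length-hₛ X ⟩
  length X * 4    ≡⟨ cong (_* 4) e ⟩
  length Y * 4    ≡⟨ length-concatMap length-μₛ Y ⟨
  length (μ Y)    ∎
  where
  length-hₛ : ∀ c → length (hₛ c) ≡ 4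
  length-hₛ p0 = refl
  length-hₛ p1 = refl
  length-hₛ ◇  = refl
  length-μₛ : ∀ c → length (μₛ c) ≡ 4
  length-μₛ p0 = refl
  length-μₛ p1 = refl
  length-μₛ ◇  = refl

length-h-++ : ∀ X Y {U V} → length X ≡ length Y → length U ≡ length V →
              length (h X ++ U) ≡ length (μ Y ++ V)
length-h-++ X Y {U} {V} e eUV = begin
  length (h X ++ U)               ≡⟨ length-++ (h X) ⟩
  length (h X) + length U         ≡⟨ cong₂ _+_ (length-h≡length-μ X Y e) eUV ⟩
  length (μ Y) + length V         ≡⟨ length-++ (μ Y) ⟨
  length (μ Y ++ V)               ∎

h-μ-≼⁻ : ∀ X Y U V {R T} → length X ≡ length Y → length U ≡ length V →
         (h X ++ U ++ R) ≼ (V ++ μ Y ++ T) → R ≼ T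
h-μ-≼⁻ X Y U V {R} {T} e eUV m =
  ≼-++⁻ʳ (h X ++ U) (V ++ μ Y) lengths
    (subst₂ _≼_ (sym (++-assoc (h X) U R)) (sym (++-assoc V (μ Y) T)) m)
  where
  lengths : length (h X ++ U) ≡ length (V ++ μ Y)
  lengths = begin
    length (h X ++ U)          ≡⟨ length-h-++ X Y e eUV ⟩
    length (μ Y ++ V)          ≡⟨ length-++ (μ Y) ⟩
    length (μ Y) + length V    ≡⟨ +-comm (length (μ Y)) (length V) ⟩
    length V + length (μ Y)    ≡⟨ length-++ V ⟨
    length (V ++ μ Y)          ∎

h-μ-≼⁺ : ∀ X Y {k U V R T} → length X ≡ length Y → ZeroPairs k U → HolePairs k V →
         R ≼ T → (h X ++ U ++ R) ≼ (V ++ μ Y ++ T)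
h-μ-≼⁺ X Y {k} {U} {V} {R} {T} e zs hs R≼T =
  subst₂ _≼_ (++-assoc (h X) U R) (++-assoc V (μ Y) T)
    (≼-++⁺ (ZeroPairs≈HolePairs (ZeroPairs-++ (h-ZeroPairs X) zs) (HolePairs-++ hs (μ-HolePairs Y)) counts)
           R≼T)
  where
  counts : length X * 2 + k ≡ k + length Y * 2
  counts = trans (cong (λ n → n * 2 + k) e) (+-comm (length Y * 2) k)

suffix : PWord
suffix = p0 ∷ p1 ∷ p0 ∷ ◇ ∷ ◇ ∷ []

needle : PSym → PWord → SolidWord
needle c X = b1 ∷ b1 ∷ h X ++ hₛ c ++ [ b0 ]

haystack : PSym → PWord → PWord
haystack c' Y = μₛ c' ++ μ Y ++ suffix

needle-unfold : ∀ c X → b1 ∷ b1 ∷ h (X ++ [ c ]) ++ [ b0 ] ≡ needle c X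
needle-unfold c X = cong (λ W → b1 ∷ b1 ∷ W) (begin
  h (X ++ [ c ]) ++ [ b0 ]          ≡⟨ cong (_++ [ b0 ]) (concatMap-++ hₛ X [ c ]) ⟩
  (h X ++ h [ c ]) ++ [ b0 ]        ≡⟨ ++-assoc (h X) (h [ c ]) [ b0 ] ⟩
  h X ++ (hₛ c ++ []) ++ [ b0 ]     ≡⟨ cong (λ W → h X ++ W ++ [ b0 ]) (++-identityʳ (hₛ c)) ⟩
  h X ++ hₛ c ++ [ b0 ]             ∎)

haystack-unfold : ∀ c' Y → μ (c' ∷ Y) ++ suffix ≡ haystack c' Y
haystack-unfold c' Y = ++-assoc (μₛ c') (μ Y) suffix

at-0 : ∀ c c' X Y → length X ≡ length Y → needle c X ≼ haystack c' Y → ¬ (c ≈ₛ c')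
at-0 _  p1 X Y e (() ∷ _)
at-0 _  ◇  X Y e (() ∷ _)
at-0 p1 p0 X Y e _ = λ ()
at-0 p0 p0 X Y e (_ ∷ _ ∷ m) with h-μ-≼⁻ X Y (b0 ∷ b1 ∷ []) (p0 ∷ ◇ ∷ []) e refl m
... | _ ∷ () ∷ _
at-0 ◇  p0 X Y e (_ ∷ _ ∷ m) with h-μ-≼⁻ X Y (b0 ∷ b0 ∷ []) (p0 ∷ ◇ ∷ []) e refl m
... | _ ∷ () ∷ _

¬at-1 : ∀ c c' X Y → length X ≡ length Y → ¬ (needle c X ≼ drop 1 (haystack c' Y))
¬at-1 _  p0 X Y e (_ ∷ () ∷ _)
¬at-1 _  ◇  X Y e (_ ∷ () ∷ _)
¬at-1 p0 p1 X Y e (_ ∷ _ ∷ m) with h-μ-≼⁻ X Y [ b0 ] [ ◇ ] e refl m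
... | _ ∷ () ∷ _
¬at-1 p1 p1 X Y e (_ ∷ _ ∷ m) with h-μ-≼⁻ X Y [ b0 ] [ ◇ ] e refl m
... | _ ∷ () ∷ _
¬at-1 ◇  p1 X Y e (_ ∷ _ ∷ m) with h-μ-≼⁻ X Y [ b0 ] [ ◇ ] e refl m
... | _ ∷ () ∷ _

at-2 : ∀ c c' X Y → length X ≡ length Y → needle c X ≼ drop 2 (haystack c' Y) → ¬ (c ≈ₛ c')
at-2 _  p0 X Y e (() ∷ _)
at-2 _  ◇  X Y e (() ∷ _)
at-2 p0 p1 X Y e _ = λ ()
at-2 p1 p1 X Y e (_ ∷ _ ∷ m) with h-μ-≼⁻ X Y [] [] e refl m
... | _ ∷ () ∷ _
at-2 ◇  p1 X Y e (_ ∷ _ ∷ m) with h-μ-≼⁻ X Y [] [] e refl m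
... | _ ∷ () ∷ _

¬beyond-2 : ∀ c c' X Y k → length X ≡ length Y → ¬ (needle c X ≼ drop (3 + k) (haystack c' Y))
¬beyond-2 c c' X Y k e m = 1+n≰n (≤-trans too-long (≤-reflexive (sym (length-h-++ X Y e (tail-length c)))))
  where
  drop-3 : ∀ c' T → drop (3 + k) (μₛ c' ++ T) ≡ drop k (◇ ∷ T)
  drop-3 p0 T = refl
  drop-3 p1 T = refl
  drop-3 ◇  T = refl
  tail-length : ∀ c → length (hₛ c ++ [ b0 ]) ≡ length suffix
  tail-length p0 = refl
  tail-length p1 = refl
  tail-length ◇  = refl
  too-long : suc (length (h X ++ hₛ c ++ [ b0 ])) ≤ length (μ Y ++ suffix)
  too-long = s≤s⁻¹ (≤-trans (≼⇒length≤ m)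
                   (≤-trans (≤-reflexive (trans (cong length (drop-3 c' (μ Y ++ suffix)))
                                                (length-drop k (◇ ∷ μ Y ++ suffix))))
                            (m∸n≤m _ k)))

occurs⇒incompatible : ∀ c c' X Y → length X ≡ length Y →
                      OccursIn (needle c X) (haystack c' Y) → ¬ (c ≈ₛ c')
occurs⇒incompatible c c' X Y e (0 , m)                 = at-0 c c' X Y e m
occurs⇒incompatible c c' X Y e (1 , m)                 = ⊥-elim (¬at-1 c c' X Y e m)
occurs⇒incompatible c c' X Y e (2 , m)                 = at-2 c c' X Y e m
occurs⇒incompatible c c' X Y e (suc (suc (suc k)) , m) = ⊥-elim (¬beyond-2 c c' X Y k e m)

incompatible⇒occurs : ∀ c c' X Y → length X ≡ length Y →
                      ¬ (c ≈ₛ c') → OccursIn (needle c X) (haystack c' Y)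
incompatible⇒occurs p0 p1 X Y e _ = 2 , tt ∷ tt ∷ h-μ-≼⁺ X Y e [] [] (tt ∷ tt ∷ tt ∷ tt ∷ tt ∷ [])
incompatible⇒occurs p1 p0 X Y e _ = 0 , tt ∷ tt ∷ h-μ-≼⁺ X Y e (b0 ∷ []) (tt ∷ []) (tt ∷ tt ∷ tt ∷ [])
incompatible⇒occurs p0 p0 X Y e c≉c' = ⊥-elim (c≉c' tt)
incompatible⇒occurs p0 ◇  X Y e c≉c' = ⊥-elim (c≉c' tt)
incompatible⇒occurs p1 p1 X Y e c≉c' = ⊥-elim (c≉c' tt)
incompatible⇒occurs p1 ◇  X Y e c≉c' = ⊥-elim (c≉c' tt)
incompatible⇒occurs ◇  _  X Y e c≉c' = ⊥-elim (c≉c' tt)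

lemma7 : (c c' : PSym) (X Y : PWord) → length X ≡ length Y →
    (OccursIn (b1 ∷ b1 ∷ h (X ++ [ c ]) ++ [ b0 ]) (μ (c' ∷ Y) ++ (p0 ∷ p1 ∷ p0 ∷ ◇ ∷ ◇ ∷ [])) ⇔ (¬ (c ≈ₛ c')))
lemma7 c c' X Y e = mk⇔
  (λ occ → occurs⇒incompatible c c' X Y e (subst₂ OccursIn (needle-unfold c X) (haystack-unfold c' Y) occ))
  (λ c≉c' → subst₂ OccursIn (sym (needle-unfold c X)) (sym (haystack-unfold c' Y))
                            (incompatible⇒occurs c c' X Y e c≉c'))
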